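{- Let $\mathbf{CAs}=\{\mathbf{CAs}^{(\gamma)}:\gamma\ge1\}$, ordered by $\mathbf{CAs}^{(\gamma)}\preceq_{\mathrm{d}}\mathbf{CAs}^{(\gamma')}$ iff there exists an operad morphism $\mathbf{CAs}^{(\gamma')}\to\mathbf{CAs}^{(\gamma)}$. For positive integers $\gamma,\gamma'$ define $$\mathbf{CAs}^{(\gamma)}\wedge_{\mathrm{d}}\mathbf{CAs}^{(\gamma')}:=\mathbf{CAs}^{(\gcd(\gamma-1,\gamma'-1)+1)},\qquad \mathbf{CAs}^{(\gamma)}\vee_{\mathrm{d}}\mathbf{CAs}^{(\gamma')}:=\mathbf{CAs}^{(\mathrm{lcm}(\gamma-1,\gamma'-1)+1)}.$$ Then $(\mathbf{CAs},\preceq_{\mathrm{d}},\wedge_{\mathrm{d}},\vee_{\mathrm{d}})$ is a lattice (with $\wedge_{\mathrm{d}}$ the meet and $\vee_{\mathrm{d}}$ the join).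
   Context: A binary tree is either the leaf or an ordered pair of binary trees. $\mathbf{Mag}$ is the nonsymmetric set-theoretic operad of binary trees ($\mathbf{Mag}(n)$ = trees with $n$ leaves), with $\mathfrak{t}\circ_i\mathfrak{s}$ grafting the root of $\mathfrak{s}$ onto the $i$-th leaf of $\mathfrak{t}$. Combs: $\mathrm{LComb}_1=\mathrm{RComb}_1=(\text{leaf},\text{leaf})$, $\mathrm{LComb}_d=(\mathrm{LComb}_{d-1},\text{leaf})$, $\mathrm{RComb}_d=(\text{leaf},\mathrm{RComb}_{d-1})$. For $\gamma\ge1$, $\equiv_\gamma$ is the smallest operad congruence on $\mathbf{Mag}$ with $\mathrm{LComb}_\gamma\equiv_\gamma\mathrm{RComb}_\gamma$, and $\mathbf{CAs}^{(\gamma)}:=\mathbf{Mag}/_{\equiv_\gamma}$. Operad morphisms preserve arity, unit and partial compositions. $\gcd$ and $\mathrm{lcm}$ are taken on $\mathbb{N}$ with the conventions $\gcd(0,a)=a$ and $\mathrm{lcm}(0,a)=0$. -}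

module Defs where

open import Data.Nat using (ℕ; zero; suc; _+_; _∸_; _<_; _≤_; _<ᵇ_; s≤s; z≤n)
open import Data.Bool using (if_then_else_)
open import Data.Product using (Σ; _,_; proj₁)
open import Data.Nat.GCD using (gcd)
open import Data.Nat.LCM using (lcm)
open import Relation.Binary.PropositionalEquality using (_≡_)

data Tree : Set where
  leaf : Tree
  node : Tree → Tree → Tree

-- number of leaves; Mag(n) = trees t with leaves t ≡ n
leaves : Tree → ℕ
leaves leaf       = 1
leaves (node l r) = leaves l + leaves r

-- Partial composition of Mag: graft t i s = t ∘_{i+1} s, i.e. graft the
-- root of s onto the leaf of t of 0-based index i (leaves numbered left to
-- right).  Only meaningful for i < leaves t; out of range it leaves t alone.
graft : Tree → ℕ → Tree → Tree
graft leaf zero    s = s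
graft leaf (suc i) s = leaf
graft (node l r) i s =
  if i <ᵇ leaves l
  then node (graft l i s) r
  else node l (graft r (i ∸ leaves l) s)

-- Combs.  LComb d / RComb d for d ≥ 1 as in the paper (LComb 0 = RComb 0 =
-- leaf is a junk value, never used since γ ≥ 1 below).
LComb : ℕ → Tree
LComb zero          = leaf
LComb (suc zero)    = node leaf leaf
LComb (suc (suc d)) = node (LComb (suc d)) leaf

RComb : ℕ → Tree
RComb zero          = leaf
RComb (suc zero)    = node leaf leaf
RComb (suc (suc d)) = node leaf (RComb (suc d))

data Cong (γ : ℕ) : Tree → Tree → Set where
  gen     : Cong γ (LComb γ) (RComb γ)
  c-refl  : ∀ {t} → Cong γ t t
  c-sym   : ∀ {t u} → Cong γ t u → Cong γ u t
  c-trans : ∀ {t u v} → Cong γ t u → Cong γ u v → Cong γ t v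
  c-comp  : ∀ {t t′ s s′} i → i < leaves t →
            Cong γ t t′ → Cong γ s s′ →
            Cong γ (graft t i s) (graft t′ i s′)

-- Operad morphisms CAs^(γ′) → CAs^(γ), where CAs^(γ) = Mag/≡γ.
-- Quotients are represented as setoids: a morphism is given by a map on
-- representatives that respects the congruences, preserves arity, the
-- unit (class of the leaf) and all partial compositions (up to ≡γ).

record Morphism (γ′ γ : ℕ) : Set where
  field
    map     : Tree → Tree
    arity   : ∀ t → leaves (map t) ≡ leaves t
    respect : ∀ {t u} → Cong γ′ t u → Cong γ (map t) (map u)
    unit    : Cong γ (map leaf) leaf
    comp    : ∀ t i s → i < leaves t →
              Cong γ (map (graft t i s)) (graft (map t) i (map s))

CAs : Set
CAs = Σ ℕ (λ γ → 1 ≤ γ)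

_⪯d_ : CAs → CAs → Set
(γ , _) ⪯d (γ′ , _) = Morphism γ′ γ

_∧d_ : CAs → CAs → CAs
(γ , _) ∧d (γ′ , _) = (suc (gcd (γ ∸ 1) (γ′ ∸ 1)) , s≤s z≤n)

_∨d_ : CAs → CAs → CAs
(γ , _) ∨d (γ′ , _) = (suc (lcm (γ ∸ 1) (γ′ ∸ 1)) , s≤s z≤n)

-- The leftmost depth of a tree (length of its leftmost branch) is additive
-- under grafting on the first leaf and unchanged by grafting elsewhere, while
-- LComb γ and RComb γ have leftmost depths γ and 1.  Hence it is invariant
-- modulo γ - 1 under ≡γ, and an operad morphism CAs^(γ′) → CAs^(γ) preserves
-- it modulo γ - 1 (it is determined by the image of the binary generator,
-- whose leftmost depth is 1); applied to the two combs this forces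
-- (γ - 1) ∣ (γ′ - 1).  Conversely, if γ - 1 divides γ′ - 1 then the relation
-- LComb γ′ ≡ RComb γ′ follows by sliding γ - 1 nodes at a time from the left
-- spine to the right spine, so the identity is a morphism.  The order is thus
-- divisibility of γ - 1, whose lattice operations are gcd and lcm.
module Submission where

open import Defs
open import Relation.Binary.PropositionalEquality using (_≡_)
open import Relation.Binary.Lattice.Structures using (IsLattice)

open import Level using (0ℓ)
open import Data.Bool using (true; false)
open import Data.Integer as ℤ using (+_)
open import Data.Integer.Divisibility.Signed as ℤ∣ using (∣⇒∣ᵤ)
import Data.Integer.Properties as ℤ
open import Data.Integer.Tactic.RingSolver using (solve-∀)
open import Data.Nat using (ℕ; zero; suc; _+_; _*_; _∸_; _<_; _<ᵇ_; s≤s; z≤n)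
open import Data.Nat.Divisibility using (_∣_; divides; ∣-reflexive; ∣-trans; ∣-antisym)
open import Data.Nat.GCD using (gcd[m,n]∣m; gcd[m,n]∣n; gcd-greatest)
open import Data.Nat.LCM using (m∣lcm[m,n]; n∣lcm[m,n]; lcm-least)
open import Data.Nat.Properties using (+-comm; +-assoc; +-identityʳ; +-suc; n∸n≡0; ≤-refl)
open import Data.Product using (∃-syntax; _,_)
open import Relation.Binary.Bundles using (Setoid)
import Relation.Binary.Reasoning.Setoid as ≈-Reasoning
open import Relation.Binary.PropositionalEquality using (refl; sym; trans; cong; isEquivalence)

infix 4 _≡_mod_

record _≡_mod_ (a b m : ℕ) : Set where
  constructor ≡-mod
  field
    ∣-difference : + m ℤ∣.∣ (+ a ℤ.- + b)

private
  ≡-mod-respects : ∀ {m i j} → i ≡ j → + m ℤ∣.∣ i → + m ℤ∣.∣ j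
  ≡-mod-respects refl m∣i = m∣i

≡-mod-refl : ∀ {m a} → a ≡ a mod m
≡-mod-refl {a = a} = ≡-mod (≡-mod-respects (sym (ℤ.+-inverseʳ (+ a))) (ℤ∣.divides (+ 0) refl))

≡-mod-sym : ∀ {m a b} → a ≡ b mod m → b ≡ a mod m
≡-mod-sym {a = a} {b} (≡-mod a≡b) = ≡-mod (≡-mod-respects (negate-diff (+ a) (+ b)) (ℤ∣.∣m⇒∣-m a≡b))
  where
  negate-diff : ∀ x y → ℤ.- (x ℤ.- y) ≡ y ℤ.- x
  negate-diff = solve-∀

≡-mod-trans : ∀ {m a b c} → a ≡ b mod m → b ≡ c mod m → a ≡ c mod m
≡-mod-trans {a = a} {b} {c} (≡-mod a≡b) (≡-mod b≡c) =
  ≡-mod (≡-mod-respects (telescope (+ a) (+ b) (+ c)) (ℤ∣.∣m∣n⇒∣m+n a≡b b≡c))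
  where
  telescope : ∀ x y z → (x ℤ.- y) ℤ.+ (y ℤ.- z) ≡ x ℤ.- z
  telescope = solve-∀

+-cong-mod : ∀ {m a b c d} → a ≡ b mod m → c ≡ d mod m → a + c ≡ b + d mod m
+-cong-mod {a = a} {b} {c} {d} (≡-mod a≡b) (≡-mod c≡d) =
  ≡-mod (≡-mod-respects (regroup (+ a) (+ b) (+ c) (+ d)) (ℤ∣.∣m∣n⇒∣m+n a≡b c≡d))
  where
  regroup : ∀ x y z w → (x ℤ.- y) ℤ.+ (z ℤ.- w) ≡ (x ℤ.+ z) ℤ.- (y ℤ.+ w)
  regroup = solve-∀

≡-mod-setoid : ℕ → Setoid 0ℓ 0ℓ
≡-mod-setoid m = record
  { Carrier       = ℕ
  ; _≈_           = λ a b → a ≡ b mod m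
  ; isEquivalence = record { refl = ≡-mod-refl ; sym = ≡-mod-sym ; trans = ≡-mod-trans }
  }

suc-≡-1-mod : ∀ m → suc m ≡ 1 mod m
suc-≡-1-mod m = ≡-mod (ℤ∣.divides (+ 1) (trans (ℤ.m-n≡m⊖n (suc m) 1) (sym (ℤ.*-identityˡ (+ m)))))

suc-≡-1-mod⇒∣ : ∀ {n d} → suc d ≡ 1 mod n → n ∣ d
suc-≡-1-mod⇒∣ {n} {d} (≡-mod 1+d≡1) = ∣⇒∣ᵤ (≡-mod-respects (ℤ.m-n≡m⊖n (suc d) 1) 1+d≡1)

leftDepth : Tree → ℕ
leftDepth leaf       = 0
leftDepth (node l _) = suc (leftDepth l)

leaves-suc : ∀ t → ∃[ k ] leaves t ≡ suc k
leaves-suc leaf = 0 , refl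
leaves-suc (node l r) with leaves-suc l
... | k , eq rewrite eq = k + leaves r , refl

0<leaves : ∀ t → 0 < leaves t
0<leaves t with leaves-suc t
... | k , eq rewrite eq = s≤s z≤n

graft-node-zero : ∀ l r s → graft (node l r) 0 s ≡ node (graft l 0 s) r
graft-node-zero l r s with leaves-suc l
... | k , eq rewrite eq = refl

leftDepth-graft-zero : ∀ t s → leftDepth (graft t 0 s) ≡ leftDepth t + leftDepth s
leftDepth-graft-zero leaf       s = refl
leftDepth-graft-zero (node l r) s rewrite graft-node-zero l r s = cong suc (leftDepth-graft-zero l s)

leftDepth-graft-suc : ∀ t i s → leftDepth (graft t (suc i) s) ≡ leftDepth t
leftDepth-graft-suc leaf       i s = refl
leftDepth-graft-suc (node l r) i s with suc i <ᵇ leaves l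
... | true  = cong suc (leftDepth-graft-suc l i s)
... | false = refl

leaves≡1⇒leaf : ∀ t → leaves t ≡ 1 → t ≡ leaf
leaves≡1⇒leaf leaf       _  = refl
leaves≡1⇒leaf (node l r) eq with leaves-suc l | leaves-suc r
... | k , eqˡ | j , eqʳ rewrite eqˡ | eqʳ | +-suc k j with eq
... | ()

leaves≡2⇒leftDepth≡1 : ∀ t → leaves t ≡ 2 → leftDepth t ≡ 1
leaves≡2⇒leftDepth≡1 (node l r) eq with leaves-suc l | leaves-suc r
... | zero  , eqˡ | _ rewrite leaves≡1⇒leaf l eqˡ = refl
... | suc k , eqˡ | j , eqʳ rewrite eqˡ | eqʳ | +-suc k j with eq
... | ()

leftDepth-LComb : ∀ d → leftDepth (LComb d) ≡ d
leftDepth-LComb zero          = refl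
leftDepth-LComb (suc zero)    = refl
leftDepth-LComb (suc (suc d)) = cong suc (leftDepth-LComb (suc d))

leftDepth-RComb-suc : ∀ d → leftDepth (RComb (suc d)) ≡ 1
leftDepth-RComb-suc zero    = refl
leftDepth-RComb-suc (suc d) = refl

leftDepth-combs-mod : ∀ γ → leftDepth (LComb γ) ≡ leftDepth (RComb γ) mod (γ ∸ 1)
leftDepth-combs-mod zero = ≡-mod-refl
leftDepth-combs-mod (suc d) rewrite leftDepth-LComb (suc d) | leftDepth-RComb-suc d = suc-≡-1-mod d

Cong⇒leftDepth-mod : ∀ {γ t u} → Cong γ t u → leftDepth t ≡ leftDepth u mod (γ ∸ 1)
Cong⇒leftDepth-mod {γ} gen           = leftDepth-combs-mod γ
Cong⇒leftDepth-mod c-refl            = ≡-mod-refl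
Cong⇒leftDepth-mod (c-sym t≡u)       = ≡-mod-sym (Cong⇒leftDepth-mod t≡u)
Cong⇒leftDepth-mod (c-trans t≡u u≡v) = ≡-mod-trans (Cong⇒leftDepth-mod t≡u) (Cong⇒leftDepth-mod u≡v)
Cong⇒leftDepth-mod (c-comp {t} {t′} {s} {s′} zero _ t≡t′ s≡s′)
  rewrite leftDepth-graft-zero t s | leftDepth-graft-zero t′ s′ =
  +-cong-mod (Cong⇒leftDepth-mod t≡t′) (Cong⇒leftDepth-mod s≡s′)
Cong⇒leftDepth-mod (c-comp {t} {t′} {s} {s′} (suc i) _ t≡t′ _)
  rewrite leftDepth-graft-suc t i s | leftDepth-graft-suc t′ i s′ = Cong⇒leftDepth-mod t≡t′

module _ {γ′ γ : ℕ} (M : Morphism γ′ γ) where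
  open Morphism M

  -- node l r = graft (node leaf r) 0 l  and  node leaf r = graft (node leaf leaf) 1 r
  Morphism⇒leftDepth-mod : ∀ t → leftDepth (map t) ≡ leftDepth t mod (γ ∸ 1)
  Morphism⇒leftDepth-mod leaf = Cong⇒leftDepth-mod unit
  Morphism⇒leftDepth-mod (node l r) = begin
    leftDepth (map (node l r))                           ≈⟨ Cong⇒leftDepth-mod (comp (node leaf r) 0 l (s≤s z≤n)) ⟩
    leftDepth (graft (map (node leaf r)) 0 (map l))      ≡⟨ leftDepth-graft-zero (map (node leaf r)) (map l) ⟩
    leftDepth (map (node leaf r)) + leftDepth (map l)    ≈⟨ +-cong-mod map-spine (Morphism⇒leftDepth-mod l) ⟩
    1 + leftDepth l                                      ∎
    where
    open ≈-Reasoning (≡-mod-setoid (γ ∸ 1))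
    binary : Tree
    binary = node leaf leaf
    map-spine : leftDepth (map (node leaf r)) ≡ 1 mod (γ ∸ 1)
    map-spine = begin
      leftDepth (map (node leaf r))                  ≈⟨ Cong⇒leftDepth-mod (comp binary 1 r (s≤s (s≤s z≤n))) ⟩
      leftDepth (graft (map binary) 1 (map r))       ≡⟨ leftDepth-graft-suc (map binary) 0 (map r) ⟩
      leftDepth (map binary)                         ≡⟨ leaves≡2⇒leftDepth≡1 (map binary) (arity binary) ⟩
      1                                              ∎

Morphism⇒∣ : ∀ {d n} → Morphism (suc d) (suc n) → n ∣ d
Morphism⇒∣ {d} {n} M = suc-≡-1-mod⇒∣ (begin
  suc d                            ≡⟨ sym (leftDepth-LComb (suc d)) ⟩
  leftDepth (LComb (suc d))        ≈⟨ ≡-mod-sym (Morphism⇒leftDepth-mod M (LComb (suc d))) ⟩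
  leftDepth (map (LComb (suc d)))  ≈⟨ Cong⇒leftDepth-mod (respect gen) ⟩
  leftDepth (map (RComb (suc d)))  ≈⟨ Morphism⇒leftDepth-mod M (RComb (suc d)) ⟩
  leftDepth (RComb (suc d))        ≡⟨ leftDepth-RComb-suc d ⟩
  1                                ∎)
  where
  open Morphism M
  open ≈-Reasoning (≡-mod-setoid n)

Cong-setoid : ℕ → Setoid 0ℓ 0ℓ
Cong-setoid γ = record
  { Carrier       = Tree
  ; _≈_           = Cong γ
  ; isEquivalence = record { refl = c-refl ; sym = c-sym ; trans = c-trans }
  }

LComb-suc : ∀ n → LComb (suc n) ≡ node (LComb n) leaf
LComb-suc zero    = refl
LComb-suc (suc n) = refl

RComb-suc : ∀ n → RComb (suc n) ≡ node leaf (RComb n)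
RComb-suc zero    = refl
RComb-suc (suc n) = refl

leaves-LComb : ∀ n → leaves (LComb n) ≡ suc n
leaves-LComb zero    = refl
leaves-LComb (suc n) rewrite LComb-suc n | leaves-LComb n = cong suc (+-comm n 1)

n<ᵇn≡false : ∀ n → (n <ᵇ n) ≡ false
n<ᵇn≡false zero    = refl
n<ᵇn≡false (suc n) = n<ᵇn≡false n

graft-LComb-first : ∀ n a → graft (LComb n) 0 (LComb a) ≡ LComb (a + n)
graft-LComb-first zero    a = cong LComb (sym (+-identityʳ a))
graft-LComb-first (suc n) a
  rewrite LComb-suc n | graft-node-zero (LComb n) leaf (LComb a) | graft-LComb-first n a | +-suc a n
  = sym (LComb-suc (a + n))

graft-LComb-last : ∀ n s → graft (LComb (suc n)) (suc n) s ≡ node (LComb n) s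
graft-LComb-last n s rewrite LComb-suc n | leaves-LComb n | n<ᵇn≡false n | n∸n≡0 n = refl

graft-RComb-last : ∀ n b → graft (RComb n) n (RComb b) ≡ RComb (n + b)
graft-RComb-last zero    b = refl
graft-RComb-last (suc n) b rewrite RComb-suc n | graft-RComb-last n b = sym (RComb-suc (n + b))

module _ (n : ℕ) where
  open ≈-Reasoning (Cong-setoid (suc n))

  -- The generator, with s grafted on its last leaf and LComb a on its first.
  Cong-LComb-shift : ∀ a s → Cong (suc n) (node (LComb (a + n)) s) (node (LComb a) (graft (RComb n) n s))
  Cong-LComb-shift a s = begin
    node (LComb (a + n)) s                                 ≡⟨ cong (λ t → node t s) (graft-LComb-first n a) ⟨
    node (graft (LComb n) 0 (LComb a)) s                   ≡⟨ graft-node-zero (LComb n) s (LComb a) ⟨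
    graft (node (LComb n) s) 0 (LComb a)                   ≡⟨ cong (λ t → graft t 0 (LComb a)) (graft-LComb-last n s) ⟨
    graft (graft (LComb (suc n)) (suc n) s) 0 (LComb a)    ≈⟨ c-comp 0 (0<leaves grafted) (c-comp (suc n) last-leaf gen c-refl) c-refl ⟩
    graft (graft (RComb (suc n)) (suc n) s) 0 (LComb a)    ≡⟨ cong (λ t → graft (graft t (suc n) s) 0 (LComb a)) (RComb-suc n) ⟩
    node (LComb a) (graft (RComb n) n s)                   ∎
    where
    grafted : Tree
    grafted = graft (LComb (suc n)) (suc n) s
    last-leaf : suc n < leaves (LComb (suc n))
    last-leaf rewrite leaves-LComb (suc n) = ≤-refl

  Cong-LComb-multiple-shift : ∀ k b → Cong (suc n) (node (LComb (k * n)) (RComb b)) (node leaf (RComb (k * n + b)))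
  Cong-LComb-multiple-shift zero    b = c-refl
  Cong-LComb-multiple-shift (suc k) b = begin
    node (LComb (n + k * n)) (RComb b)                  ≡⟨ cong (λ m → node (LComb m) (RComb b)) (+-comm n (k * n)) ⟩
    node (LComb (k * n + n)) (RComb b)                  ≈⟨ Cong-LComb-shift (k * n) (RComb b) ⟩
    node (LComb (k * n)) (graft (RComb n) n (RComb b))  ≡⟨ cong (node (LComb (k * n))) (graft-RComb-last n b) ⟩
    node (LComb (k * n)) (RComb (n + b))                ≈⟨ Cong-LComb-multiple-shift k (n + b) ⟩
    node leaf (RComb (k * n + (n + b)))                 ≡⟨ cong (λ m → node leaf (RComb m)) reassociate ⟩
    node leaf (RComb (n + k * n + b))                   ∎
    where
    reassociate : k * n + (n + b) ≡ n + k * n + b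
    reassociate = trans (sym (+-assoc (k * n) n b)) (cong (_+ b) (+-comm (k * n) n))

  Cong-combs-multiple : ∀ k → Cong (suc n) (LComb (suc (k * n))) (RComb (suc (k * n)))
  Cong-combs-multiple k = begin
    LComb (suc (k * n))                ≡⟨ LComb-suc (k * n) ⟩
    node (LComb (k * n)) (RComb 0)     ≈⟨ Cong-LComb-multiple-shift k 0 ⟩
    node leaf (RComb (k * n + 0))      ≡⟨ cong (λ m → node leaf (RComb m)) (+-identityʳ (k * n)) ⟩
    node leaf (RComb (k * n))          ≡⟨ RComb-suc (k * n) ⟨
    RComb (suc (k * n))                ∎

Cong-mono-∣ : ∀ {n d} → n ∣ d → ∀ {t u} → Cong (suc d) t u → Cong (suc n) t u
Cong-mono-∣ {n} (divides k refl) gen     = Cong-combs-multiple n k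
Cong-mono-∣ n∣d c-refl                    = c-refl
Cong-mono-∣ n∣d (c-sym t≡u)               = c-sym (Cong-mono-∣ n∣d t≡u)
Cong-mono-∣ n∣d (c-trans t≡u u≡v)         = c-trans (Cong-mono-∣ n∣d t≡u) (Cong-mono-∣ n∣d u≡v)
Cong-mono-∣ n∣d (c-comp i i<n t≡t′ s≡s′) = c-comp i i<n (Cong-mono-∣ n∣d t≡t′) (Cong-mono-∣ n∣d s≡s′)

∣⇒Morphism : ∀ {n d} → n ∣ d → Morphism (suc d) (suc n)
∣⇒Morphism n∣d = record
  { map     = λ t → t
  ; arity   = λ _ → refl
  ; respect = Cong-mono-∣ n∣d
  ; unit    = c-refl
  ; comp    = λ _ _ _ _ → c-refl
  }

index : CAs → ℕ
index (γ , _) = γ ∸ 1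

⪯d⇒∣ : ∀ x y → x ⪯d y → index x ∣ index y
⪯d⇒∣ (suc _ , _) (suc _ , _) = Morphism⇒∣

∣⇒⪯d : ∀ x y → index x ∣ index y → x ⪯d y
∣⇒⪯d (suc _ , _) (suc _ , _) = ∣⇒Morphism

index-injective : ∀ x y → index x ≡ index y → x ≡ y
index-injective (suc _ , s≤s z≤n) (suc _ , s≤s z≤n) refl = refl

theorem3p2p8 : IsLattice {A = CAs} _≡_ _⪯d_ _∨d_ _∧d_
theorem3p2p8 = record
  { isPartialOrder = record
    { isPreorder = record
      { isEquivalence = isEquivalence
      ; reflexive     = λ {x} {y} x≡y → ∣⇒⪯d x y (∣-reflexive (cong index x≡y))
      ; trans         = λ {x} {y} {z} x⪯y y⪯z → ∣⇒⪯d x z (∣-trans (⪯d⇒∣ x y x⪯y) (⪯d⇒∣ y z y⪯z))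
      }
    ; antisym = λ {x} {y} x⪯y y⪯x → index-injective x y (∣-antisym (⪯d⇒∣ x y x⪯y) (⪯d⇒∣ y x y⪯x))
    }
  ; supremum = λ x y →
      ∣⇒⪯d x (x ∨d y) (m∣lcm[m,n] (index x) (index y))
    , ∣⇒⪯d y (x ∨d y) (n∣lcm[m,n] (index x) (index y))
    , λ z x⪯z y⪯z → ∣⇒⪯d (x ∨d y) z (lcm-least (⪯d⇒∣ x z x⪯z) (⪯d⇒∣ y z y⪯z))
  ; infimum = λ x y →
      ∣⇒⪯d (x ∧d y) x (gcd[m,n]∣m (index x) (index y))
    , ∣⇒⪯d (x ∧d y) y (gcd[m,n]∣n (index x) (index y))
    , λ z z⪯x z⪯y → ∣⇒⪯d z (x ∧d y) (gcd-greatest (⪯d⇒∣ z x z⪯x) (⪯d⇒∣ z y z⪯y))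
  }
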